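{- Let $G=(V,E)$ be a directed graph, $K\geq 2$ an integer, and $\mathscr C$ its set of directed cycle covers. Then \[ \sum_{C\in\mathscr C} h(C) = \sum_{Z\subseteq V}(-1)^{|V\setminus Z|}\sum_{F\in\mathscr F(Z)} h(F) \pmod K, \] where for an edge subset $T\subseteq E$, \[ h(T)=\frac{1}{K}\sum_{Y_1,\ldots,Y_K}\prod_{e\in T}[\,e\in G[Y_1]\cup\cdots\cup G[Y_K]\,], \] the sum ranging over all ordered $K$-partitions $(Y_1,\ldots,Y_K)$ of $V$ (possibly empty parts), and $\mathscr F(Z)$ is the family of edge subsets $F\subseteq E$ in which every vertex has outdegree exactly $1$ and every edge has its terminal (head) in $Z$; equivalently, the total functions $f\colon V\to Z$ with $(v,f(v))\in E$ for all $v\in V$.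
   Context: A directed cycle cover is a set of directed edges of $G$ forming vertex-disjoint directed cycles that together cover every vertex. $[P]$ is $1$ if $P$ holds and $0$ otherwise. $e\in G[Y]$ means the directed edge $e$ has both endpoints in $Y$. -}

module Defs where

open import Data.Bool using (Bool; true; false; if_then_else_; _∧_; _∨_; not)
open import Data.Nat using (ℕ; zero; suc; _∸_; _≡ᵇ_)
open import Data.Fin using (Fin; _≟_)
open import Data.Fin.Base using () renaming (zero to fzero; suc to fsuc)
open import Data.List using (List; []; _∷_; map; concatMap; allFin; foldr)
open import Data.Nat.ListAction using (sum; product)
open import Data.Bool.ListAction using (all)
open import Data.Integer using (ℤ; +_)
open import Data.Rational.Unnormalised using (ℚᵘ; mkℚᵘ; 0ℚᵘ; 1ℚᵘ; _+_; _*_; -_; _-_; _≃_)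
open import Data.Product using (∃)
open import Relation.Nullary.Decidable using (⌊_⌋)

allFuns : ∀ {A : Set} (m : ℕ) → List A → List (Fin m → A)
allFuns zero    xs = (λ ()) ∷ []
allFuns (suc m) xs =
  concatMap (λ a → map (λ f → λ { fzero → a ; (fsuc i) → f i }) (allFuns m xs)) xs

Σℚ : ∀ {A : Set} → List A → (A → ℚᵘ) → ℚᵘ
Σℚ xs g = foldr _+_ 0ℚᵘ (map g xs)

Σℚ[_] : ∀ {A : Set} → (A → Bool) → List A → (A → ℚᵘ) → ℚᵘ
Σℚ[ p ] xs g = Σℚ xs (λ x → if p x then g x else 0ℚᵘ)

negOnePow : ℕ → ℚᵘ
negOnePow zero    = 1ℚᵘ
negOnePow (suc m) = - negOnePow m

bools : List Bool
bools = true ∷ false ∷ []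

count : ∀ {n} → (Fin n → Bool) → ℕ
count {n} p = sum (map (λ i → if p i then 1 else 0) (allFin n))

-- Directed graphs on vertex set V = Fin n.
-- E u v = true  iff  (u , v) is a directed edge u → v (tail u, head v).

Digraph : ℕ → Set
Digraph n = Fin n → Fin n → Bool

EdgeSet : ℕ → Set
EdgeSet n = Fin n → Fin n → Bool

allEdgeSets : ∀ n → List (EdgeSet n)
allEdgeSets n = allFuns n (allFuns n bools)

_⊆ᴱ_ : ∀ {n} → EdgeSet n → Digraph n → Bool
_⊆ᴱ_ {n} T E = all (λ u → all (λ v → not (T u v) ∨ E u v) (allFin n)) (allFin n)

outdeg indeg : ∀ {n} → EdgeSet n → Fin n → ℕ
outdeg T u = count (λ v → T u v)
indeg  T v = count (λ u → T u v)

-- Directed cycle cover: a set of edges of G forming vertex-disjoint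
-- directed cycles covering every vertex, i.e. an edge subset of E in which
-- every vertex has outdegree exactly 1 and indegree exactly 1.
isCycleCover : ∀ {n} → Digraph n → EdgeSet n → Bool
isCycleCover {n} E T =
  (T ⊆ᴱ E) ∧ all (λ v → (outdeg T v ≡ᵇ 1) ∧ (indeg T v ≡ᵇ 1)) (allFin n)

-- h(T) = (1/K) Σ_{(Y₁,…,Y_K)} Π_{e ∈ T} [e ∈ G[Y₁] ∪ ⋯ ∪ G[Y_K]]
-- An ordered K-partition (Y₁,…,Y_K) of V (empty parts allowed) is given by
-- the map c : V → Fin K sending v to the index of its part; an edge (u,v)
-- lies in G[Y₁] ∪ ⋯ ∪ G[Y_K] iff c u = c v.

inSomePart : ∀ {n K} → (Fin n → Fin K) → Fin n → Fin n → ℕ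
inSomePart c u v = if ⌊ c u ≟ c v ⌋ then 1 else 0

partitionSum : ∀ {n} (K : ℕ) → EdgeSet n → ℕ
partitionSum {n} K T =
  sum (map (λ c → product (map (λ u → product (map (λ v →
          if T u v then inSomePart c u v else 1) (allFin n))) (allFin n)))
       (allFuns n (allFin K)))

-- h(T) = partitionSum / K ;  mkℚᵘ p q denotes p / (q+1), so for K ≥ 1
-- this is exactly partitionSum K T / K.
h : ∀ {n} (K : ℕ) → EdgeSet n → ℚᵘ
h K T = mkℚᵘ (+ partitionSum K T) (K ∸ 1)

isInF : ∀ {n} → Digraph n → (Z : Fin n → Bool) → (Fin n → Fin n) → Bool
isInF {n} E Z f = all (λ v → Z (f v) ∧ E v (f v)) (allFin n)

edgesOf : ∀ {n} → (Fin n → Fin n) → EdgeSet n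
edgesOf f u v = ⌊ f u ≟ v ⌋

_≡_[modℚ_] : ℚᵘ → ℚᵘ → ℕ → Set
a ≡ b [modℚ K ] = ∃ λ (z : ℤ) → (a - b) ≃ (mkℚᵘ (+ K) 0 * mkℚᵘ z 0)

lhs : ∀ {n} → Digraph n → ℕ → ℚᵘ
lhs {n} E K = Σℚ[ isCycleCover E ] (allEdgeSets n) (h K)

rhs : ∀ {n} → Digraph n → ℕ → ℚᵘ
rhs {n} E K =
  Σℚ (allFuns n bools) (λ Z →
    negOnePow (count (λ v → not (Z v))) *
    Σℚ[ isInF E Z ] (allFuns n (allFin n)) (λ f → h K (edgesOf f)))

-- An edge set in which every vertex has outdegree one is the graph of a unique function
-- f : V → V, and it is a directed cycle cover of G exactly when f is a permutation with all
-- edges (v , f v) in E; as V is finite, f is a permutation iff it is surjective, and then every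
-- indegree is one by pigeonhole. On the other side, exchanging the sums over Z and f turns the
-- right-hand side into Σ_f h(f) [f follows E] Σ_{Z ⊇ f(V)} (-1)^{|V ∖ Z|}, and by
-- inclusion–exclusion the inner sum is [f(V) = V]. So both sides equal the sum of h over the
-- permutations along E: the identity holds exactly, not only modulo K.

module Submission where

open import Defs
open import Algebra.Bundles using (CommutativeSemiring; CommutativeRing)
open import Data.Bool using (Bool; true; false; T; not; _∧_; _∨_; if_then_else_)
open import Data.Bool.ListAction using (all; and)
open import Data.Fin using (Fin; zero; suc; _≟_)
open import Data.List using (List; []; _∷_; _++_; map; concat; concatMap; foldr; tabulate; allFin)
import Data.List.Properties as List
open import Data.Nat using (ℕ; zero; suc; _≤_)
open import Function using (_∘_)
open import Relation.Binary.PropositionalEquality as ≡ using (_≡_)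

module BigOperators {c ℓ} (R : CommutativeSemiring c ℓ) where

  open CommutativeSemiring R hiding (zero)
  open import Algebra.Properties.CommutativeMonoid.Sum *-commutativeMonoid public
    using () renaming (sum to ∏; sum-cong-≋ to ∏-cong; ∑-distrib-+ to ∏-distrib-*)
  open import Algebra.Properties.CommutativeMonoid.Sum *-commutativeMonoid
    using () renaming (sum-replicate-zero to ∏-replicate-one)
  open import Algebra.Properties.CommutativeSemigroup +-commutativeSemigroup
    using () renaming (interchange to +-interchange)
  open import Relation.Binary.Reasoning.Setoid setoid

  private variable A B : Set

  ∑ : List A → (A → Carrier) → Carrier
  ∑ xs g = foldr _+_ 0# (map g xs)

  𝕀 : Bool → Carrier
  𝕀 b = if b then 1# else 0#

  ∑-cong : (xs : List A) {g g′ : A → Carrier} → (∀ x → g x ≈ g′ x) → ∑ xs g ≈ ∑ xs g′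
  ∑-cong []       g≈g′ = refl
  ∑-cong (x ∷ xs) g≈g′ = +-cong (g≈g′ x) (∑-cong xs g≈g′)

  ∑-zero : (xs : List A) → ∑ xs (λ _ → 0#) ≈ 0#
  ∑-zero []       = refl
  ∑-zero (x ∷ xs) = trans (+-identityˡ _) (∑-zero xs)

  ∑-distrib-+ : (xs : List A) (g g′ : A → Carrier) →
                ∑ xs (λ x → g x + g′ x) ≈ ∑ xs g + ∑ xs g′
  ∑-distrib-+ []       g g′ = sym (+-identityˡ 0#)
  ∑-distrib-+ (x ∷ xs) g g′ = begin
    (g x + g′ x) + ∑ xs (λ y → g y + g′ y) ≈⟨ +-congˡ (∑-distrib-+ xs g g′) ⟩
    (g x + g′ x) + (∑ xs g + ∑ xs g′)       ≈⟨ +-interchange (g x) (g′ x) (∑ xs g) (∑ xs g′) ⟩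
    (g x + ∑ xs g) + (g′ x + ∑ xs g′)       ∎

  *-distribˡ-∑ : (a : Carrier) (xs : List A) (g : A → Carrier) →
                 a * ∑ xs g ≈ ∑ xs (λ x → a * g x)
  *-distribˡ-∑ a []       g = zeroʳ a
  *-distribˡ-∑ a (x ∷ xs) g = trans (distribˡ a (g x) _) (+-congˡ (*-distribˡ-∑ a xs g))

  *-distribʳ-∑ : (a : Carrier) (xs : List A) (g : A → Carrier) →
                 ∑ xs g * a ≈ ∑ xs (λ x → g x * a)
  *-distribʳ-∑ a xs g = begin
    ∑ xs g * a              ≈⟨ *-comm _ a ⟩
    a * ∑ xs g              ≈⟨ *-distribˡ-∑ a xs g ⟩
    ∑ xs (λ x → a * g x)    ≈⟨ ∑-cong xs (λ x → *-comm a (g x)) ⟩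
    ∑ xs (λ x → g x * a)    ∎

  ∑-comm : (xs : List A) (ys : List B) (F : A → B → Carrier) →
           ∑ xs (λ x → ∑ ys (F x)) ≈ ∑ ys (λ y → ∑ xs (λ x → F x y))
  ∑-comm []       ys F = sym (∑-zero ys)
  ∑-comm (x ∷ xs) ys F =
    trans (+-congˡ (∑-comm xs ys F)) (sym (∑-distrib-+ ys (F x) (λ y → ∑ xs (λ x′ → F x′ y))))

  ∑-++ : (xs ys : List A) (g : A → Carrier) → ∑ (xs ++ ys) g ≈ ∑ xs g + ∑ ys g
  ∑-++ []       ys g = sym (+-identityˡ _)
  ∑-++ (x ∷ xs) ys g = trans (+-congˡ (∑-++ xs ys g)) (sym (+-assoc (g x) _ _))

  ∑-concat : (xss : List (List A)) (g : A → Carrier) → ∑ (concat xss) g ≈ ∑ xss (λ xs → ∑ xs g)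
  ∑-concat []         g = refl
  ∑-concat (xs ∷ xss) g = trans (∑-++ xs (concat xss) g) (+-congˡ (∑-concat xss g))

  ∑-map : (k : B → A) (ys : List B) (g : A → Carrier) → ∑ (map k ys) g ≡ ∑ ys (g ∘ k)
  ∑-map k ys g = ≡.cong (foldr _+_ 0#) (≡.sym (List.map-∘ ys))

  ∑-concatMap : (k : B → List A) (ys : List B) (g : A → Carrier) →
                ∑ (concatMap k ys) g ≈ ∑ ys (λ y → ∑ (k y) g)
  ∑-concatMap k ys g = trans (∑-concat (map k ys) g) (reflexive (∑-map k ys (λ xs → ∑ xs g)))

  ∑-allFin-suc : ∀ {m} (g : Fin (suc m) → Carrier) →
                 ∑ (allFin (suc m)) g ≡ g zero + ∑ (allFin m) (g ∘ suc)
  ∑-allFin-suc {m} g = ≡.cong (λ ys → g zero + foldr _+_ 0# ys)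
    (≡.trans (List.map-tabulate suc g) (≡.sym (List.map-tabulate (λ i → i) (g ∘ suc))))

  ∏-one : ∀ {m} {φ : Fin m → Carrier} → (∀ i → φ i ≈ 1#) → ∏ φ ≈ 1#
  ∏-one {m} φ≈1 = trans (∏-cong φ≈1) (∏-replicate-one m)

  ∑-allFuns-∏ : ∀ m (xs : List A) (φ : Fin m → A → Carrier) →
                ∑ (allFuns m xs) (λ f → ∏ (λ i → φ i (f i))) ≈ ∏ (λ i → ∑ xs (φ i))
  ∑-allFuns-∏ zero    xs φ = +-identityʳ 1#
  ∑-allFuns-∏ (suc m) xs φ = begin
    ∑ (allFuns (suc m) xs) (λ f → ∏ (λ i → φ i (f i)))
      ≈⟨ ∑-concatMap _ xs _ ⟩
    ∑ xs (λ a → ∑ (map _ (allFuns m xs)) (λ f → ∏ (λ i → φ i (f i))))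
      ≈⟨ ∑-cong xs (λ a → reflexive (∑-map _ (allFuns m xs) _)) ⟩
    ∑ xs (λ a → ∑ (allFuns m xs) (λ f → φ zero a * ∏ (λ i → φ (suc i) (f i))))
      ≈⟨ ∑-cong xs (λ a → *-distribˡ-∑ (φ zero a) (allFuns m xs) _) ⟨
    ∑ xs (λ a → φ zero a * ∑ (allFuns m xs) (λ f → ∏ (λ i → φ (suc i) (f i))))
      ≈⟨ ∑-cong xs (λ a → *-congˡ (∑-allFuns-∏ m xs (φ ∘ suc))) ⟩
    ∑ xs (λ a → φ zero a * ∏ (λ i → ∑ xs (φ (suc i))))
      ≈⟨ *-distribʳ-∑ _ xs (φ zero) ⟨
    ∑ xs (φ zero) * ∏ (λ i → ∑ xs (φ (suc i)))
      ∎

  𝕀-∧ : ∀ a b → 𝕀 (a ∧ b) ≈ 𝕀 a * 𝕀 b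
  𝕀-∧ true  b = sym (*-identityˡ (𝕀 b))
  𝕀-∧ false b = sym (zeroˡ (𝕀 b))

  if-then-0≈𝕀* : ∀ b x → (if b then x else 0#) ≈ 𝕀 b * x
  if-then-0≈𝕀* true  x = sym (*-identityˡ x)
  if-then-0≈𝕀* false x = sym (zeroˡ x)

  𝕀*-cong : ∀ b {x y} → (T b → x ≈ y) → 𝕀 b * x ≈ 𝕀 b * y
  𝕀*-cong true  x≈y = *-congˡ (x≈y _)
  𝕀*-cong false _   = trans (zeroˡ _) (sym (zeroˡ _))

  𝕀-all-tabulate : ∀ {m} (p : A → Bool) (f : Fin m → A) → 𝕀 (all p (tabulate f)) ≈ ∏ (𝕀 ∘ p ∘ f)
  𝕀-all-tabulate {m = zero}  p f = refl
  𝕀-all-tabulate {m = suc m} p f = trans (𝕀-∧ (p (f zero)) _) (*-congˡ (𝕀-all-tabulate p (f ∘ suc)))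

  𝕀-all-allFin : ∀ {m} (p : Fin m → Bool) → 𝕀 (all p (allFin m)) ≈ ∏ (𝕀 ∘ p)
  𝕀-all-allFin p = 𝕀-all-tabulate p (λ i → i)

  𝕀-all-∧ : ∀ {m} (p q : Fin m → Bool) →
            𝕀 (all (λ i → p i ∧ q i) (allFin m)) ≈ 𝕀 (all p (allFin m)) * 𝕀 (all q (allFin m))
  𝕀-all-∧ p q = begin
    𝕀 (all (λ i → p i ∧ q i) (allFin _))  ≈⟨ 𝕀-all-allFin (λ i → p i ∧ q i) ⟩
    ∏ (λ i → 𝕀 (p i ∧ q i))               ≈⟨ ∏-cong (λ i → 𝕀-∧ (p i) (q i)) ⟩
    ∏ (λ i → 𝕀 (p i) * 𝕀 (q i))           ≈⟨ ∏-distrib-* (𝕀 ∘ p) (𝕀 ∘ q) ⟩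
    ∏ (𝕀 ∘ p) * ∏ (𝕀 ∘ q)                 ≈⟨ *-cong (𝕀-all-allFin p) (𝕀-all-allFin q) ⟨
    𝕀 (all p (allFin _)) * 𝕀 (all q (allFin _)) ∎

open import Data.Bool.Properties using () renaming (_≟_ to _≟ᴮ_)
open import Data.Empty using (⊥-elim)
open import Data.Integer using (+_)
import Data.List.Relation.Unary.All.Properties as All
open import Data.Nat using (_+_; _∸_; _≡ᵇ_; z≤n)
import Data.Nat.Properties as ℕ
open import Data.Nat.ListAction using (sum; product)
open import Data.Product using (∃; _×_; _,_; proj₁; proj₂)
open import Data.Rational.Unnormalised using (ℚᵘ; mkℚᵘ; 1ℚᵘ; _≃_; *≡*; _*_; -_)
import Data.Rational.Unnormalised as ℚᵘ
import Data.Rational.Unnormalised.Properties as ℚ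
open import Data.Unit using (tt)
open import Relation.Nullary using (yes; no; contradiction)
open import Relation.Nullary.Decidable using (⌊_⌋; toWitness; fromWitness)
open ≡ using (_≢_; refl; sym; trans; cong; cong₂; subst)
open import Algebra.Solver.CommutativeMonoid ℚ.*-1-commutativeMonoid using (solve; _⊕_; _⊜_)

T-injective : ∀ {x y} → (T x → T y) → (T y → T x) → x ≡ y
T-injective {true}  {true}  _   _   = refl
T-injective {true}  {false} x⇒y _   = ⊥-elim (x⇒y tt)
T-injective {false} {true}  _   y⇒x = ⊥-elim (y⇒x tt)
T-injective {false} {false} _   _   = refl

T-all⇒∀ : ∀ {m} (p : Fin m → Bool) → T (all p (allFin m)) → ∀ i → T (p i)
T-all⇒∀ p = All.tabulate⁻ ∘ All.all⁺ p (allFin _)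

∀⇒T-all : ∀ {m} (p : Fin m → Bool) → (∀ i → T (p i)) → T (all p (allFin m))
∀⇒T-all p = All.all⁻ p ∘ All.tabulate⁺

all-cong : ∀ {A : Set} {p q : A → Bool} (xs : List A) → (∀ x → p x ≡ q x) → all p xs ≡ all q xs
all-cong xs p≗q = cong and (List.map-cong p≗q xs)

module ℕ∑ = BigOperators ℕ.+-*-commutativeSemiring

count-suc : ∀ {m} (p : Fin (suc m) → Bool) → count p ≡ ℕ∑.𝕀 (p zero) + count (p ∘ suc)
count-suc p = ℕ∑.∑-allFin-suc (ℕ∑.𝕀 ∘ p)

count-cong : ∀ {m} {p q : Fin m → Bool} → (∀ i → p i ≡ q i) → count p ≡ count q
count-cong p≗q = ℕ∑.∑-cong (allFin _) (cong ℕ∑.𝕀 ∘ p≗q)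

count-true : ∀ m → count {m} (λ _ → true) ≡ m
count-true zero    = refl
count-true (suc m) = trans (count-suc {m} (λ _ → true)) (cong suc (count-true m))

≟-suc : ∀ {m} (a b : Fin m) → ⌊ suc a ≟ suc b ⌋ ≡ ⌊ a ≟ b ⌋
≟-suc a b with a ≟ b
... | yes _ = refl
... | no  _ = refl

count-≟ : ∀ {m} (a : Fin m) → count (λ w → ⌊ a ≟ w ⌋) ≡ 1
count-≟ {suc m} zero    = trans (count-suc {m} (λ w → ⌊ zero ≟ w ⌋)) (cong suc (ℕ∑.∑-zero (allFin m)))
count-≟ {suc m} (suc a) =
  trans (count-suc {m} (λ w → ⌊ suc a ≟ w ⌋)) (trans (count-cong (≟-suc a)) (count-≟ a))

T⇒count≢0 : ∀ {m} (p : Fin m → Bool) i → T (p i) → count p ≢ 0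
T⇒count≢0 p zero    pᵢ rewrite count-suc p with p zero
... | true = λ ()
T⇒count≢0 p (suc i) pᵢ rewrite count-suc p with p zero
... | true  = λ ()
... | false = T⇒count≢0 (p ∘ suc) i pᵢ

count≢0⇒∃ : ∀ {m} (p : Fin m → Bool) → count p ≢ 0 → ∃ λ i → T (p i)
count≢0⇒∃ {zero}  p c≢0 = contradiction refl c≢0
count≢0⇒∃ {suc m} p c≢0 rewrite count-suc p with p zero in p₀
... | true  = zero , subst T (sym p₀) tt
... | false = let i , pᵢ = count≢0⇒∃ (p ∘ suc) c≢0 in suc i , pᵢ

∑-lower-bound : ∀ {m} (d : Fin m → ℕ) → (∀ w → d w ≢ 0) → m ≤ ℕ∑.∑ (allFin m) d
∑-lower-bound {zero}  d d≢0 = z≤n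
∑-lower-bound {suc m} d d≢0 rewrite ℕ∑.∑-allFin-suc d =
  ℕ.+-mono-≤ (ℕ.n≢0⇒n>0 (d≢0 zero)) (∑-lower-bound (d ∘ suc) (d≢0 ∘ suc))

tight-sum : ∀ {a r m} → a ≢ 0 → m ≤ r → a + r ≡ suc m → a ≡ 1 × r ≡ m
tight-sum {zero}      a≢0 _   _  = contradiction refl a≢0
tight-sum {suc a} {r} _   m≤r eq = cong suc a≡0 , trans (cong (_+ r) (sym a≡0)) a+r≡m
  where
  a+r≡m = ℕ.suc-injective eq
  a≡0 = ℕ.n≤0⇒n≡0 (ℕ.+-cancelʳ-≤ r a 0 (subst (_≤ r) (sym a+r≡m) m≤r))

pigeonhole : ∀ {m} (d : Fin m → ℕ) → (∀ w → d w ≢ 0) → ℕ∑.∑ (allFin m) d ≡ m → ∀ w → d w ≡ 1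
pigeonhole {suc m} d d≢0 ∑d≡m = λ where
    zero    → proj₁ tight
    (suc w) → pigeonhole (d ∘ suc) (d≢0 ∘ suc) (proj₂ tight) w
  where
  tight = tight-sum (d≢0 zero) (∑-lower-bound (d ∘ suc) (d≢0 ∘ suc))
                    (trans (sym (ℕ∑.∑-allFin-suc d)) ∑d≡m)

open BigOperators (CommutativeRing.commutativeSemiring ℚ.+-*-commutativeRing)
open ℚ.≃-Reasoning

negOnePow-+ : ∀ a b → negOnePow (a + b) ≃ negOnePow a * negOnePow b
negOnePow-+ zero    b = ℚ.≃-sym (ℚ.*-identityˡ (negOnePow b))
negOnePow-+ (suc a) b = begin
  - negOnePow (a + b)                 ≈⟨ ℚ.-‿cong (negOnePow-+ a b) ⟩
  - (negOnePow a * negOnePow b)       ≈⟨ ℚ.neg-distribˡ-* (negOnePow a) (negOnePow b) ⟩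
  - negOnePow a * negOnePow b         ∎

negOnePow-count : ∀ {m} (p : Fin m → Bool) → negOnePow (count p) ≃ ∏ (λ i → negOnePow (ℕ∑.𝕀 (p i)))
negOnePow-count {zero}  p = ℚ.≃-refl
negOnePow-count {suc m} p = begin
  negOnePow (count p)                                     ≡⟨ cong negOnePow (count-suc p) ⟩
  negOnePow (ℕ∑.𝕀 (p zero) + count (p ∘ suc))             ≈⟨ negOnePow-+ (ℕ∑.𝕀 (p zero)) _ ⟩
  negOnePow (ℕ∑.𝕀 (p zero)) * negOnePow (count (p ∘ suc)) ≈⟨ ℚ.*-congˡ {negOnePow (ℕ∑.𝕀 (p zero))}
                                                               (negOnePow-count (p ∘ suc)) ⟩
  negOnePow (ℕ∑.𝕀 (p zero)) * ∏ (λ i → negOnePow (ℕ∑.𝕀 (p (suc i)))) ∎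

-- Σ_{Z ⊇ V ∖ O} (-1)^{|V ∖ Z|} = [O = ∅]; the sum factorises into one factor per vertex.
∑-alternating-supersets : ∀ {m} (O : Fin m → Bool) →
  ∑ (allFuns m bools) (λ Z → negOnePow (count (λ v → not (Z v))) * 𝕀 (all (λ w → O w ∨ Z w) (allFin m)))
    ≃ 𝕀 (all (not ∘ O) (allFin m))
∑-alternating-supersets {m} O = begin
  ∑ (allFuns m bools) (λ Z → negOnePow (count (λ v → not (Z v))) * 𝕀 (all (λ w → O w ∨ Z w) (allFin m)))
    ≈⟨ ∑-cong (allFuns m bools) (λ Z →
         ℚ.*-cong (negOnePow-count (not ∘ Z)) (𝕀-all-allFin (λ w → O w ∨ Z w))) ⟩
  ∑ (allFuns m bools) (λ Z → ∏ (λ w → sign (Z w)) * ∏ (λ w → 𝕀 (O w ∨ Z w)))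
    ≈⟨ ∑-cong (allFuns m bools) (λ Z → ∏-distrib-* (sign ∘ Z) (λ w → 𝕀 (O w ∨ Z w))) ⟨
  ∑ (allFuns m bools) (λ Z → ∏ (λ w → sign (Z w) * 𝕀 (O w ∨ Z w)))
    ≈⟨ ∑-allFuns-∏ m bools (λ w b → sign b * 𝕀 (O w ∨ b)) ⟩
  ∏ (λ w → ∑ bools (λ b → sign b * 𝕀 (O w ∨ b)))
    ≈⟨ ∏-cong (λ w → one-vertex (O w)) ⟩
  ∏ (λ w → 𝕀 (not (O w)))
    ≈⟨ 𝕀-all-allFin (not ∘ O) ⟨
  𝕀 (all (not ∘ O) (allFin m)) ∎
  where
  sign : Bool → ℚᵘ
  sign b = negOnePow (ℕ∑.𝕀 (not b))
  one-vertex : ∀ o → ∑ bools (λ b → sign b * 𝕀 (o ∨ b)) ≃ 𝕀 (not o)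
  one-vertex true  = *≡* refl
  one-vertex false = *≡* refl

∏-row-false : ∀ {m} (r : Fin m → Bool) → ∏ (λ v → 𝕀 ⌊ r v ≟ᴮ false ⌋) ≃ 𝕀 (count r ≡ᵇ 0)
∏-row-false {zero}  r = ℚ.≃-refl
∏-row-false {suc m} r rewrite count-suc r = begin
  𝕀 ⌊ r zero ≟ᴮ false ⌋ * ∏ (λ v → 𝕀 ⌊ r (suc v) ≟ᴮ false ⌋)
    ≈⟨ ℚ.*-congˡ {𝕀 ⌊ r zero ≟ᴮ false ⌋} (∏-row-false (r ∘ suc)) ⟩
  𝕀 ⌊ r zero ≟ᴮ false ⌋ * c₀
    ≈⟨ head-case (r zero) ⟩
  𝕀 (ℕ∑.𝕀 (r zero) + count (r ∘ suc) ≡ᵇ 0) ∎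
  where
  c₀ : ℚᵘ
  c₀ = 𝕀 (count (r ∘ suc) ≡ᵇ 0)
  head-case : ∀ b → 𝕀 ⌊ b ≟ᴮ false ⌋ * c₀ ≃ 𝕀 (ℕ∑.𝕀 b + count (r ∘ suc) ≡ᵇ 0)
  head-case true  = ℚ.*-zeroˡ c₀
  head-case false = ℚ.*-identityˡ c₀

∑-row-δ : ∀ {m} (r : Fin m → Bool) →
          ∑ (allFin m) (λ a → ∏ (λ v → 𝕀 ⌊ r v ≟ᴮ ⌊ a ≟ v ⌋ ⌋)) ≃ 𝕀 (count r ≡ᵇ 1)
∑-row-δ {zero}  r = ℚ.≃-refl
∑-row-δ {suc m} r rewrite count-suc r = begin
  ∑ (allFin (suc m)) δ-row
    ≡⟨ ∑-allFin-suc δ-row ⟩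
  δ-row zero ℚᵘ.+ ∑ (allFin m) (δ-row ∘ suc)
    ≈⟨ ℚ.+-cong (ℚ.*-congˡ {𝕀 ⌊ r zero ≟ᴮ true ⌋} (∏-row-false (r ∘ suc))) tail-rows ⟩
  𝕀 ⌊ r zero ≟ᴮ true ⌋ * c₀ ℚᵘ.+ 𝕀 ⌊ r zero ≟ᴮ false ⌋ * c₁
    ≈⟨ head-case (r zero) ⟩
  𝕀 (ℕ∑.𝕀 (r zero) + count (r ∘ suc) ≡ᵇ 1) ∎
  where
  c₀ c₁ : ℚᵘ
  c₀ = 𝕀 (count (r ∘ suc) ≡ᵇ 0)
  c₁ = 𝕀 (count (r ∘ suc) ≡ᵇ 1)
  δ-row : Fin (suc m) → ℚᵘ
  δ-row a = ∏ (λ v → 𝕀 ⌊ r v ≟ᴮ ⌊ a ≟ v ⌋ ⌋)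
  δ-tail-row : Fin m → ℚᵘ
  δ-tail-row a = ∏ (λ v → 𝕀 ⌊ r (suc v) ≟ᴮ ⌊ a ≟ v ⌋ ⌋)
  tail-rows : ∑ (allFin m) (δ-row ∘ suc) ≃ 𝕀 ⌊ r zero ≟ᴮ false ⌋ * c₁
  tail-rows = begin
    ∑ (allFin m) (δ-row ∘ suc)
      ≈⟨ ∑-cong (allFin m) (λ a → ℚ.*-congˡ {𝕀 ⌊ r zero ≟ᴮ false ⌋}
           (∏-cong (λ v → ℚ.≃-reflexive (cong (λ b → 𝕀 ⌊ r (suc v) ≟ᴮ b ⌋) (≟-suc a v))))) ⟩
    ∑ (allFin m) (λ a → 𝕀 ⌊ r zero ≟ᴮ false ⌋ * δ-tail-row a)
      ≈⟨ *-distribˡ-∑ (𝕀 ⌊ r zero ≟ᴮ false ⌋) (allFin m) δ-tail-row ⟨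
    𝕀 ⌊ r zero ≟ᴮ false ⌋ * ∑ (allFin m) δ-tail-row
      ≈⟨ ℚ.*-congˡ {𝕀 ⌊ r zero ≟ᴮ false ⌋} (∑-row-δ (r ∘ suc)) ⟩
    𝕀 ⌊ r zero ≟ᴮ false ⌋ * c₁ ∎
  head-case : ∀ b → 𝕀 ⌊ b ≟ᴮ true ⌋ * c₀ ℚᵘ.+ 𝕀 ⌊ b ≟ᴮ false ⌋ * c₁
                    ≃ 𝕀 (ℕ∑.𝕀 b + count (r ∘ suc) ≡ᵇ 1)
  head-case true  = ℚ.≃-trans (ℚ.+-cong (ℚ.*-identityˡ c₀) (ℚ.*-zeroˡ c₁)) (ℚ.+-identityʳ c₀)
  head-case false = ℚ.≃-trans (ℚ.+-cong (ℚ.*-zeroˡ c₀) (ℚ.*-identityˡ c₁)) (ℚ.+-identityˡ c₁)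

_≗ᴱ_ : ∀ {n} → EdgeSet n → EdgeSet n → Set
S ≗ᴱ S′ = ∀ u v → S u v ≡ S′ u v

isGraphOf : ∀ {n} → (Fin n → Fin n) → EdgeSet n → Bool
isGraphOf {n} f S = all (λ u → all (λ v → ⌊ S u v ≟ᴮ edgesOf f u v ⌋) (allFin n)) (allFin n)

isGraphOf⇒≗ᴱ : ∀ {n} (f : Fin n → Fin n) (S : EdgeSet n) → T (isGraphOf f S) → S ≗ᴱ edgesOf f
isGraphOf⇒≗ᴱ f S graph u v =
  toWitness (T-all⇒∀ _ (T-all⇒∀ (λ u → all (λ v → ⌊ S u v ≟ᴮ edgesOf f u v ⌋) (allFin _)) graph u) v)

𝕀-isGraphOf : ∀ {n} (f : Fin n → Fin n) (S : EdgeSet n) →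
              𝕀 (isGraphOf f S) ≃ ∏ (λ u → ∏ (λ v → 𝕀 ⌊ S u v ≟ᴮ ⌊ f u ≟ v ⌋ ⌋))
𝕀-isGraphOf {n} f S = ℚ.≃-trans
  (𝕀-all-allFin (λ u → all (λ v → ⌊ S u v ≟ᴮ edgesOf f u v ⌋) (allFin n)))
  (∏-cong (λ u → 𝕀-all-allFin (λ v → ⌊ S u v ≟ᴮ edgesOf f u v ⌋)))

∑-isGraphOf-edgeSets : ∀ {n} (f : Fin n → Fin n) → ∑ (allEdgeSets n) (λ S → 𝕀 (isGraphOf f S)) ≃ 1ℚᵘ
∑-isGraphOf-edgeSets {n} f = begin
  ∑ (allEdgeSets n) (λ S → 𝕀 (isGraphOf f S))
    ≈⟨ ∑-cong (allEdgeSets n) (𝕀-isGraphOf f) ⟩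
  ∑ (allEdgeSets n) (λ S → ∏ (λ u → ∏ (λ v → 𝕀 ⌊ S u v ≟ᴮ edgesOf f u v ⌋)))
    ≈⟨ ∑-allFuns-∏ n (allFuns n bools) (λ u r → ∏ (λ v → 𝕀 ⌊ r v ≟ᴮ edgesOf f u v ⌋)) ⟩
  ∏ (λ u → ∑ (allFuns n bools) (λ r → ∏ (λ v → 𝕀 ⌊ r v ≟ᴮ edgesOf f u v ⌋)))
    ≈⟨ ∏-cong (λ u → ∑-allFuns-∏ n bools (λ v b → 𝕀 ⌊ b ≟ᴮ edgesOf f u v ⌋)) ⟩
  ∏ (λ u → ∏ (λ v → ∑ bools (λ b → 𝕀 ⌊ b ≟ᴮ edgesOf f u v ⌋)))
    ≈⟨ ∏-one (λ u → ∏-one (λ v → one-value (edgesOf f u v))) ⟩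
  1ℚᵘ ∎
  where
  one-value : ∀ c → ∑ bools (λ b → 𝕀 ⌊ b ≟ᴮ c ⌋) ≃ 1ℚᵘ
  one-value true  = *≡* refl
  one-value false = *≡* refl

allOutdegOne allIndegOne : ∀ {n} → EdgeSet n → Bool
allOutdegOne {n} S = all (λ u → outdeg S u ≡ᵇ 1) (allFin n)
allIndegOne  {n} S = all (λ v → indeg S v ≡ᵇ 1) (allFin n)

∑-isGraphOf-functions : ∀ {n} (S : EdgeSet n) →
                        ∑ (allFuns n (allFin n)) (λ f → 𝕀 (isGraphOf f S)) ≃ 𝕀 (allOutdegOne S)
∑-isGraphOf-functions {n} S = begin
  ∑ (allFuns n (allFin n)) (λ f → 𝕀 (isGraphOf f S))
    ≈⟨ ∑-cong (allFuns n (allFin n)) (λ f → 𝕀-isGraphOf f S) ⟩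
  ∑ (allFuns n (allFin n)) (λ f → ∏ (λ u → ∏ (λ v → 𝕀 ⌊ S u v ≟ᴮ ⌊ f u ≟ v ⌋ ⌋)))
    ≈⟨ ∑-allFuns-∏ n (allFin n) (λ u a → ∏ (λ v → 𝕀 ⌊ S u v ≟ᴮ ⌊ a ≟ v ⌋ ⌋)) ⟩
  ∏ (λ u → ∑ (allFin n) (λ a → ∏ (λ v → 𝕀 ⌊ S u v ≟ᴮ ⌊ a ≟ v ⌋ ⌋)))
    ≈⟨ ∏-cong (λ u → ∑-row-δ (S u)) ⟩
  ∏ (λ u → 𝕀 (outdeg S u ≡ᵇ 1))
    ≈⟨ 𝕀-all-allFin (λ u → outdeg S u ≡ᵇ 1) ⟨
  𝕀 (allOutdegOne S) ∎

-- Double counting of the pairs (S , f) with S the graph of f.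
∑-allOutdegOne : ∀ {n} (Q : EdgeSet n → ℚᵘ) → (∀ {S S′} → S ≗ᴱ S′ → Q S ≃ Q S′) →
  ∑ (allEdgeSets n) (λ S → 𝕀 (allOutdegOne S) * Q S) ≃ ∑ (allFuns n (allFin n)) (Q ∘ edgesOf)
∑-allOutdegOne {n} Q Q-cong = begin
  ∑ ES (λ S → 𝕀 (allOutdegOne S) * Q S)
    ≈⟨ ∑-cong ES (λ S → ℚ.*-congʳ (∑-isGraphOf-functions S)) ⟨
  ∑ ES (λ S → ∑ Fs (λ f → 𝕀 (isGraphOf f S)) * Q S)
    ≈⟨ ∑-cong ES (λ S → *-distribʳ-∑ (Q S) Fs (λ f → 𝕀 (isGraphOf f S))) ⟩
  ∑ ES (λ S → ∑ Fs (λ f → 𝕀 (isGraphOf f S) * Q S))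
    ≈⟨ ∑-cong ES (λ S → ∑-cong Fs (λ f → 𝕀*-cong (isGraphOf f S) (Q-cong ∘ isGraphOf⇒≗ᴱ f S))) ⟩
  ∑ ES (λ S → ∑ Fs (λ f → 𝕀 (isGraphOf f S) * Q (edgesOf f)))
    ≈⟨ ∑-comm ES Fs (λ S f → 𝕀 (isGraphOf f S) * Q (edgesOf f)) ⟩
  ∑ Fs (λ f → ∑ ES (λ S → 𝕀 (isGraphOf f S) * Q (edgesOf f)))
    ≈⟨ ∑-cong Fs (λ f → *-distribʳ-∑ (Q (edgesOf f)) ES (λ S → 𝕀 (isGraphOf f S))) ⟨
  ∑ Fs (λ f → ∑ ES (λ S → 𝕀 (isGraphOf f S)) * Q (edgesOf f))
    ≈⟨ ∑-cong Fs (λ f → ℚ.≃-trans (ℚ.*-congʳ (∑-isGraphOf-edgeSets f)) (ℚ.*-identityˡ _)) ⟩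
  ∑ Fs (Q ∘ edgesOf) ∎
  where
  ES = allEdgeSets n
  Fs = allFuns n (allFin n)

alongEdges : ∀ {n} → Digraph n → (Fin n → Fin n) → Bool
alongEdges {n} E f = all (λ v → E v (f v)) (allFin n)

isSurjective : ∀ {n} → (Fin n → Fin n) → Bool
isSurjective {n} f = all (λ w → not (indeg (edgesOf f) w ≡ᵇ 0)) (allFin n)

edgesOf-⊆ᴱ : ∀ {n} (E : Digraph n) (f : Fin n → Fin n) → (edgesOf f ⊆ᴱ E) ≡ alongEdges E f
edgesOf-⊆ᴱ {n} E f = T-injective
  (λ f⊆E → ∀⇒T-all _ (λ u → at-image u (T-all⇒∀ (inside u) (T-all⇒∀ _ f⊆E u) (f u))))
  (λ along → ∀⇒T-all _ (λ u → ∀⇒T-all (inside u) (λ v → off-image u v (T-all⇒∀ _ along u))))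
  where
  inside : Fin n → Fin n → Bool
  inside u v = not (edgesOf f u v) ∨ E u v
  at-image : ∀ u → T (inside u (f u)) → T (E u (f u))
  at-image u with f u ≟ f u
  ... | yes _  = λ e → e
  ... | no f≢f = contradiction refl f≢f
  off-image : ∀ u v → T (E u (f u)) → T (inside u v)
  off-image u v e with f u ≟ v
  ... | yes refl = e
  ... | no _     = tt

handshake : ∀ {n} (f : Fin n → Fin n) → ℕ∑.∑ (allFin n) (indeg (edgesOf f)) ≡ n
handshake {n} f = trans (ℕ∑.∑-comm (allFin n) (allFin n) (λ w u → ℕ∑.𝕀 ⌊ f u ≟ w ⌋))
                        (trans (ℕ∑.∑-cong (allFin n) (count-≟ ∘ f)) (count-true n))

allIndegOne-edgesOf : ∀ {n} (f : Fin n → Fin n) → allIndegOne (edgesOf f) ≡ isSurjective f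
allIndegOne-edgesOf {n} f = T-injective
  (λ ones → ∀⇒T-all _ (λ w → one⇒nonzero (d w) (T-all⇒∀ _ ones w)))
  (λ surj → ∀⇒T-all _ (λ w → ℕ.≡⇒≡ᵇ (d w) 1
     (pigeonhole d (λ w → nonzero (d w) (T-all⇒∀ _ surj w)) (handshake f) w)))
  where
  d : Fin n → ℕ
  d = indeg (edgesOf f)
  one⇒nonzero : ∀ c → T (c ≡ᵇ 1) → T (not (c ≡ᵇ 0))
  one⇒nonzero c c≡1 rewrite ℕ.≡ᵇ⇒≡ c 1 c≡1 = tt
  nonzero : ∀ c → T (not (c ≡ᵇ 0)) → c ≢ 0
  nonzero (suc _) _ ()

all-image : ∀ {n} (f : Fin n → Fin n) (Z : Fin n → Bool) →
  all (λ v → Z (f v)) (allFin n) ≡ all (λ w → (indeg (edgesOf f) w ≡ᵇ 0) ∨ Z w) (allFin n)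
all-image {n} f Z = T-injective
  (λ Z∘f → ∀⇒T-all _ (λ w → preimage w (T-all⇒∀ _ Z∘f)))
  (λ cover → ∀⇒T-all _ (λ v →
     resolve (d (f v)) (T⇒count≢0 _ v (fromWitness refl)) (T-all⇒∀ _ cover (f v))))
  where
  d : Fin n → ℕ
  d = indeg (edgesOf f)
  preimage : ∀ w → (∀ v → T (Z (f v))) → T ((d w ≡ᵇ 0) ∨ Z w)
  preimage w Z∘f with d w in d≡
  ... | zero  = tt
  ... | suc _ = let v , fv≡w = count≢0⇒∃ (λ u → ⌊ f u ≟ w ⌋) (subst (_≢ 0) (sym d≡) λ ())
                in subst (T ∘ Z) (toWitness fv≡w) (Z∘f v)
  resolve : ∀ c {z} → c ≢ 0 → T ((c ≡ᵇ 0) ∨ z) → T z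
  resolve zero    c≢0 _ = contradiction refl c≢0
  resolve (suc _) _   z = z

h-cong : ∀ {n} K {S S′ : EdgeSet n} → S ≗ᴱ S′ → h K S ≡ h K S′
h-cong {n} K S≗S′ = cong (λ s → mkℚᵘ (+ s) (K ∸ 1)) (cong sum (List.map-cong (λ c →
  cong product (List.map-cong (λ u → cong product (List.map-cong (λ v →
    cong (λ b → if b then inSomePart c u v else 1) (S≗S′ u v)) (allFin n))) (allFin n)))
  (allFuns n (allFin K))))

allIndegOne-cong : ∀ {n} {S S′ : EdgeSet n} → S ≗ᴱ S′ → allIndegOne S ≡ allIndegOne S′
allIndegOne-cong S≗S′ = all-cong (allFin _) (λ v → cong (_≡ᵇ 1) (count-cong (λ u → S≗S′ u v)))

⊆ᴱ-cong : ∀ {n} (E : Digraph n) {S S′ : EdgeSet n} → S ≗ᴱ S′ → (S ⊆ᴱ E) ≡ (S′ ⊆ᴱ E)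
⊆ᴱ-cong E S≗S′ =
  all-cong (allFin _) (λ u → all-cong (allFin _) (λ v → cong (λ b → not b ∨ E u v) (S≗S′ u v)))

module _ {n : ℕ} (E : Digraph n) (K : ℕ) where

  surjectionSum : ℚᵘ
  surjectionSum = ∑ (allFuns n (allFin n))
    (λ f → 𝕀 (isSurjective f) * (𝕀 (alongEdges E f) * h K (edgesOf f)))

  lhs≃surjectionSum : lhs E K ≃ surjectionSum
  lhs≃surjectionSum = begin
    lhs E K
      ≈⟨ ∑-cong ES (λ S → if-then-0≈𝕀* (isCycleCover E S) (h K S)) ⟩
    ∑ ES (λ S → 𝕀 (isCycleCover E S) * h K S)
      ≈⟨ ∑-cong ES cycleCover-split ⟩
    ∑ ES (λ S → 𝕀 (allOutdegOne S) * Q S)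
      ≈⟨ ∑-allOutdegOne Q Q-cong ⟩
    ∑ Fs (Q ∘ edgesOf)
      ≈⟨ ∑-cong Fs (λ f → ℚ.≃-reflexive (cong₂ (λ a b → 𝕀 a * (𝕀 b * h K (edgesOf f)))
                                              (allIndegOne-edgesOf f) (edgesOf-⊆ᴱ E f))) ⟩
    surjectionSum ∎
    where
    ES = allEdgeSets n
    Fs = allFuns n (allFin n)
    Q : EdgeSet n → ℚᵘ
    Q S = 𝕀 (allIndegOne S) * (𝕀 (S ⊆ᴱ E) * h K S)
    Q-cong : ∀ {S S′} → S ≗ᴱ S′ → Q S ≃ Q S′
    Q-cong S≗S′ = ℚ.≃-reflexive (cong₂ _*_ (cong 𝕀 (allIndegOne-cong S≗S′))
                                            (cong₂ _*_ (cong 𝕀 (⊆ᴱ-cong E S≗S′)) (h-cong K S≗S′)))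
    cycleCover-split : ∀ S → 𝕀 (isCycleCover E S) * h K S ≃ 𝕀 (allOutdegOne S) * Q S
    cycleCover-split S = begin
      𝕀 (isCycleCover E S) * h K S
        ≈⟨ ℚ.*-congʳ (ℚ.≃-trans (𝕀-∧ (S ⊆ᴱ E) _)
             (ℚ.*-congˡ {𝕀 (S ⊆ᴱ E)} (𝕀-all-∧ (λ v → outdeg S v ≡ᵇ 1) (λ v → indeg S v ≡ᵇ 1)))) ⟩
      (𝕀 (S ⊆ᴱ E) * (𝕀 (allOutdegOne S) * 𝕀 (allIndegOne S))) * h K S
        ≈⟨ solve 4 (λ a o i x → (a ⊕ (o ⊕ i)) ⊕ x ⊜ o ⊕ (i ⊕ (a ⊕ x))) ℚ.≃-refl
             (𝕀 (S ⊆ᴱ E)) (𝕀 (allOutdegOne S)) (𝕀 (allIndegOne S)) (h K S) ⟩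
      𝕀 (allOutdegOne S) * Q S ∎

  rhs≃surjectionSum : rhs E K ≃ surjectionSum
  rhs≃surjectionSum = begin
    rhs E K
      ≈⟨ ∑-cong Bs (λ Z → ℚ.*-congˡ {sgn Z}
           (∑-cong Fs (λ f → if-then-0≈𝕀* (isInF E Z f) (h K (edgesOf f))))) ⟩
    ∑ Bs (λ Z → sgn Z * ∑ Fs (λ f → 𝕀 (isInF E Z f) * h K (edgesOf f)))
      ≈⟨ ∑-cong Bs (λ Z → *-distribˡ-∑ (sgn Z) Fs (λ f → 𝕀 (isInF E Z f) * h K (edgesOf f))) ⟩
    ∑ Bs (λ Z → ∑ Fs (λ f → sgn Z * (𝕀 (isInF E Z f) * h K (edgesOf f))))
      ≈⟨ ∑-comm Bs Fs (λ Z f → sgn Z * (𝕀 (isInF E Z f) * h K (edgesOf f))) ⟩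
    ∑ Fs (λ f → ∑ Bs (λ Z → sgn Z * (𝕀 (isInF E Z f) * h K (edgesOf f))))
      ≈⟨ ∑-cong Fs (λ f → ∑-cong Bs (λ Z → isInF-split Z f)) ⟩
    ∑ Fs (λ f → ∑ Bs (λ Z → (sgn Z * 𝕀 (covers f Z)) * (𝕀 (alongEdges E f) * h K (edgesOf f))))
      ≈⟨ ∑-cong Fs (λ f → *-distribʳ-∑ _ Bs (λ Z → sgn Z * 𝕀 (covers f Z))) ⟨
    ∑ Fs (λ f → ∑ Bs (λ Z → sgn Z * 𝕀 (covers f Z)) * (𝕀 (alongEdges E f) * h K (edgesOf f)))
      ≈⟨ ∑-cong Fs (λ f → ℚ.*-congʳ (∑-alternating-supersets (λ w → indeg (edgesOf f) w ≡ᵇ 0))) ⟩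
    surjectionSum ∎
    where
    Bs = allFuns n bools
    Fs = allFuns n (allFin n)
    sgn : (Fin n → Bool) → ℚᵘ
    sgn Z = negOnePow (count (λ v → not (Z v)))
    covers : (Fin n → Fin n) → (Fin n → Bool) → Bool
    covers f Z = all (λ w → (indeg (edgesOf f) w ≡ᵇ 0) ∨ Z w) (allFin n)
    isInF-split : ∀ Z f → sgn Z * (𝕀 (isInF E Z f) * h K (edgesOf f))
                        ≃ (sgn Z * 𝕀 (covers f Z)) * (𝕀 (alongEdges E f) * h K (edgesOf f))
    isInF-split Z f = begin
      sgn Z * (𝕀 (isInF E Z f) * h K (edgesOf f))
        ≈⟨ ℚ.*-congˡ {sgn Z} (ℚ.*-congʳ (𝕀-all-∧ (Z ∘ f) (λ v → E v (f v)))) ⟩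
      sgn Z * ((𝕀 (all (Z ∘ f) (allFin n)) * 𝕀 (alongEdges E f)) * h K (edgesOf f))
        ≡⟨ cong (λ b → sgn Z * ((𝕀 b * 𝕀 (alongEdges E f)) * h K (edgesOf f))) (all-image f Z) ⟩
      sgn Z * ((𝕀 (covers f Z) * 𝕀 (alongEdges E f)) * h K (edgesOf f))
        ≈⟨ solve 4 (λ s c a x → s ⊕ ((c ⊕ a) ⊕ x) ⊜ (s ⊕ c) ⊕ (a ⊕ x)) ℚ.≃-refl
             (sgn Z) (𝕀 (covers f Z)) (𝕀 (alongEdges E f)) (h K (edgesOf f)) ⟩
      (sgn Z * 𝕀 (covers f Z)) * (𝕀 (alongEdges E f) * h K (edgesOf f)) ∎

≃⇒≡[modℚ] : ∀ {a b : ℚᵘ} K → a ≃ b → a ≡ b [modℚ K ]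
≃⇒≡[modℚ] {a} {b} K a≃b =
  + 0 , ℚ.≃-trans (ℚ.p≃q⇒p-q≃0 a b a≃b) (ℚ.≃-sym (ℚ.*-zeroʳ (mkℚᵘ (+ K) 0)))

lemma8 : (n : ℕ) (E : Digraph n) (K : ℕ) → 2 ≤ K →
           lhs E K ≡ rhs E K [modℚ K ]
lemma8 n E K _ = ≃⇒≡[modℚ] K (ℚ.≃-trans (lhs≃surjectionSum E K) (ℚ.≃-sym (rhs≃surjectionSum E K)))
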